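{- Let $G$ be a finite vertex-transitive graph in which every vertex has a nonadjacent twin (respectively, an adjacent twin), and let $Q$ denote the nonadjacent (respectively, adjacent) twin quotient graph of $G$. Let $T\le \mathrm{Aut}(G)$ be the subgroup generated by all twin transpositions, and let $\lambda:\mathrm{Aut}(G)\to\mathrm{Aut}(Q)$ be the homomorphism $\lambda(\alpha)([u])=[\alpha(u)]$. Then $\lambda$ is surjective and $\mathrm{Aut}(G)\cong T\rtimes \mathrm{Aut}(Q)$.
   Context: In a graph $G=(V,E)$, $N(u)$ is the open neighborhood and $N[u]=N(u)\cup\{u\}$ the closed neighborhood of $u$. Distinct vertices $u,v$ are nonadjacent twins if $N(u)=N(v)$, adjacent twins if $N[u]=N[v]$. The nonadjacent (resp. adjacent) twin classes are the equivalence classes of the relation $N(u)=N(v)$ (resp. $N[u]=N[v]$); the corresponding twin quotient graph has these classes as vertices, two distinct classes being adjacent iff some representatives are adjacent in $G$. If $u,v$ are twins (of either kind), the twin transposition $\tau_{u,v}$ is the permutation of $V$ swapping $u$ and $v$ and fixing all other vertices; it is an automorphism of $G$. The kernel of $\lambda$ is $T$. -}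

module Defs where

open import Data.Nat using (ℕ)
open import Data.Fin using (Fin; _≟_)
open import Data.Bool using (Bool; true; false; _∨_)
open import Data.Product using (Σ; ∃; ∃₂; _×_; _,_)
open import Relation.Nullary using (¬_)
open import Relation.Nullary.Decidable using (⌊_⌋)
open import Relation.Binary.PropositionalEquality using (_≡_; _≢_)
open import Function.Bundles using (_⇔_)
open import Data.Fin.Permutation
  using (Permutation′; _⟨$⟩ʳ_; _∘ₚ_; id; flip; transpose; _≈_)

record Graph (n : ℕ) : Set where
  field
    E     : Fin n → Fin n → Bool
    sym   : ∀ u v → E u v ≡ E v u
    irrefl : ∀ u → E u u ≡ false
open Graph public

module _ {n : ℕ} (G : Graph n) where

  closedNbh : Fin n → Fin n → Bool
  closedNbh u w = ⌊ w ≟ u ⌋ ∨ E G u w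

  IsAut : Permutation′ n → Set
  IsAut σ = ∀ u v → E G (σ ⟨$⟩ʳ u) (σ ⟨$⟩ʳ v) ≡ E G u v

  VertexTransitive : Set
  VertexTransitive = ∀ u v → ∃ λ σ → IsAut σ × σ ⟨$⟩ʳ u ≡ v

data TwinKind : Set where
  nonadjacent adjacent : TwinKind

module _ {n : ℕ} (k : TwinKind) (G : Graph n) where

  nbh : Fin n → Fin n → Bool
  nbh = nbhOf k
    where
    nbhOf : TwinKind → Fin n → Fin n → Bool
    nbhOf nonadjacent = E G
    nbhOf adjacent    = closedNbh G

  SameNbh : Fin n → Fin n → Set
  SameNbh u v = ∀ w → nbh u w ≡ nbh v w

  Twins : Fin n → Fin n → Set
  Twins u v = u ≢ v × SameNbh u v

  -- T: the subgroup of Aut(G) generated by the twin transpositions,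
  -- i.e. permutations (pointwise) equal to a finite product of twin transpositions.
  -- (Twin transpositions are involutions, so no inverses are needed.)
  data InTwinGroup : Permutation′ n → Set where
    gen-id   : ∀ {σ} → σ ≈ id → InTwinGroup σ
    gen-step : ∀ {σ ρ u v} → InTwinGroup ρ → Twins u v →
               σ ≈ (ρ ∘ₚ transpose u v) → InTwinGroup σ

record TwinQuotient {n : ℕ} (k : TwinKind) (G : Graph n) (m : ℕ) : Set where
  field
    cls      : Fin n → Fin m
    cls-surj : ∀ i → ∃ λ u → cls u ≡ i
    cls-eq   : ∀ u v → (cls u ≡ cls v) ⇔ SameNbh k G u v
open TwinQuotient public

module _ {n m : ℕ} {k : TwinKind} {G : Graph n} (Q : TwinQuotient k G m) where

  QAdj : Fin m → Fin m → Set
  QAdj i j = i ≢ j × ∃₂ λ u v → cls Q u ≡ i × cls Q v ≡ j × E G u v ≡ true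

  IsAutQ : Permutation′ m → Set
  IsAutQ β = ∀ i j → QAdj i j ⇔ QAdj (β ⟨$⟩ʳ i) (β ⟨$⟩ʳ j)

  LambdaIs : Permutation′ n → Permutation′ m → Set
  LambdaIs α β = ∀ u → cls Q (α ⟨$⟩ʳ u) ≡ β ⟨$⟩ʳ cls Q u

  -- Aut(G) is the internal semidirect product T ⋊ H with H ≅ Aut(Q):
  -- s : Aut(Q) → Aut(G) is an injective homomorphism (a section of λ) with image H,
  -- T is normal in Aut(G), T ∩ H = 1 and T·H = Aut(G).
  SemidirectDecomposition : Set
  SemidirectDecomposition =
    (∀ α t → IsAut G α → InTwinGroup k G t → InTwinGroup k G (flip α ∘ₚ t ∘ₚ α))
    × Σ (Permutation′ m → Permutation′ n) λ s →
        (∀ β → IsAutQ β → IsAut G (s β))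
      × (∀ β β' → IsAutQ β → IsAutQ β' → β ≈ β' → s β ≈ s β')
      × (∀ β β' → IsAutQ β → IsAutQ β' → s (β ∘ₚ β') ≈ (s β ∘ₚ s β'))
      × (∀ β β' → IsAutQ β → IsAutQ β' → s β ≈ s β' → β ≈ β')
      × (∀ β → IsAutQ β → LambdaIs (s β) β)
      × (∀ β → IsAutQ β → InTwinGroup k G (s β) → s β ≈ id)
      × (∀ α → IsAut G α → ∃₂ λ t β → InTwinGroup k G t × IsAutQ β × α ≈ (s β ∘ₚ t))

{-# OPTIONS --safe #-}
-- Automorphisms of G permute the twin classes, which defines λ, and a permutation fixing every
-- twin class is a product of twin transpositions (send the points back one at a time), so
-- ker λ = T. Vertex transitivity gives automorphisms τ_j carrying the class of a base vertex
-- u₀ onto each class j, and s(β)(u) = τ_{β[u]} (τ_{[u]}⁻¹ u) is a homomorphic section of λ.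
-- Inside a class s(β) agrees with the automorphism τ_{β[u]} τ_{[u]}⁻¹, and between distinct
-- classes adjacency only depends on the classes, so it is read off in Q and preserved by β.
-- A surjection with kernel T and a homomorphic section splits: Aut(G) = T ⋊ s(Aut(Q)).
module Submission where

open import Defs hiding (sym)
open import Data.Nat using (ℕ; zero; suc)
open import Data.Fin using (Fin; _≟_)
open import Data.Fin.Patterns using (0F)
open import Data.Fin.Permutation
  using (Permutation′; _⟨$⟩ʳ_; _⟨$⟩ˡ_; _∘ₚ_; id; flip; transpose; _≈_; permutation
        ; inverseˡ; inverseʳ)
import Data.Fin.Permutation.Components as PC
open import Data.List using (List; []; _∷_; allFin)
open import Data.List.Membership.Propositional using (_∉_)
open import Data.List.Membership.Propositional.Properties using (∈-allFin)
open import Data.List.Relation.Unary.Any using (here; there)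
open import Data.Bool using (true; _∨_)
open import Data.Bool.Properties using (⇔→≡)
open import Data.Product using (∃; _×_; _,_; proj₁; proj₂)
open import Relation.Nullary using (yes; no; does; contradiction)
open import Relation.Nullary.Decidable using (dec-true; dec-false; does-⇔; isYes≗does)
open import Relation.Binary.Definitions using (Reflexive; Symmetric; Transitive)
open import Relation.Binary.PropositionalEquality
open import Function.Bundles using (_⇔_; mk⇔; Equivalence; Injection)
open import Function.Properties.Inverse using (↔⇒↣)
import Function.Properties.Equivalence as ⇔
open ≡-Reasoning

permutation-injective : ∀ {n} (π : Permutation′ n) {x y} → π ⟨$⟩ʳ x ≡ π ⟨$⟩ʳ y → x ≡ y
permutation-injective π = Injection.injective (↔⇒↣ π)

transpose-matchˡ : ∀ {n} (i j : Fin n) → PC.transpose i j i ≡ j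
transpose-matchˡ i j rewrite dec-true (i ≟ i) refl = refl

transpose-fixes : ∀ {n} {i j k : Fin n} → k ≢ i → k ≢ j → PC.transpose i j k ≡ k
transpose-fixes {i = i} {j} {k} k≢i k≢j rewrite dec-false (k ≟ i) k≢i | dec-false (k ≟ j) k≢j = refl

transpose-preserves : ∀ {n ℓ} (R : Fin n → Fin n → Set ℓ) → Reflexive R → Symmetric R →
                      ∀ {i j} → R i j → ∀ k → R (PC.transpose i j k) k
transpose-preserves _ R-refl R-sym {i} {j} Rij k with k ≟ i
... | yes refl = R-sym Rij
... | no _ with k ≟ j
...   | yes refl = Rij
...   | no _ = R-refl

FixedOutside : ∀ {n} → List (Fin n) → Permutation′ n → Set
FixedOutside ys π = ∀ x → x ∉ ys → π ⟨$⟩ʳ x ≡ x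

fixedOutside-∷ : ∀ {n} {y : Fin n} {ys π} → FixedOutside (y ∷ ys) π → π ⟨$⟩ʳ y ≡ y →
                 FixedOutside ys π
fixedOutside-∷ {y = y} fixed πy≡y x x∉ys with x ≟ y
... | yes refl = πy≡y
... | no x≢y = fixed x λ { (here x≡y) → x≢y x≡y ; (there x∈ys) → x∉ys x∈ys }

fixedOutside-∘transpose : ∀ {n} {y : Fin n} {ys π} → FixedOutside (y ∷ ys) π →
                          FixedOutside ys (π ∘ₚ transpose (π ⟨$⟩ʳ y) y)
fixedOutside-∘transpose {y = y} {π = π} fixed =
  fixedOutside-∷ {π = π ∘ₚ transpose (π ⟨$⟩ʳ y) y} fixed′ (transpose-matchˡ (π ⟨$⟩ʳ y) y)
  where
  fixed′ : FixedOutside (y ∷ _) (π ∘ₚ transpose (π ⟨$⟩ʳ y) y)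
  fixed′ x x∉ = trans (cong (PC.transpose (π ⟨$⟩ʳ y) y) πx≡x) (transpose-fixes x≢πy x≢y)
    where
    πx≡x = fixed x x∉
    x≢y = λ x≡y → x∉ (here x≡y)
    x≢πy = λ x≡πy → x≢y (permutation-injective π (trans πx≡x x≡πy))

IsAut-flip : ∀ {n} (G : Graph n) α → IsAut G α → IsAut G (flip α)
IsAut-flip G α A u v =
  trans (sym (A (α ⟨$⟩ˡ u) (α ⟨$⟩ˡ v))) (cong₂ (E G) (inverseʳ α) (inverseʳ α))

closedNbh-≢ : ∀ {n} (G : Graph n) {u v} → v ≢ u → closedNbh G u v ≡ E G u v
closedNbh-≢ G {u} {v} v≢u with v ≟ u
... | yes v≡u = contradiction v≡u v≢u
... | no _ = refl

IsAut⇒nbh-invariant : ∀ k {n} (G : Graph n) α → IsAut G α →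
                      ∀ u w → nbh k G (α ⟨$⟩ʳ u) (α ⟨$⟩ʳ w) ≡ nbh k G u w
IsAut⇒nbh-invariant nonadjacent G α A u w = A u w
IsAut⇒nbh-invariant adjacent G α A u w =
  cong₂ _∨_ (trans (isYes≗does _) (trans same-equality (sym (isYes≗does _)))) (A u w)
  where
  same-equality : does (α ⟨$⟩ʳ w ≟ α ⟨$⟩ʳ u) ≡ does (w ≟ u)
  same-equality =
    does-⇔ (mk⇔ (permutation-injective α) (cong (α ⟨$⟩ʳ_))) (α ⟨$⟩ʳ w ≟ α ⟨$⟩ʳ u) (w ≟ u)

sameNbh⇒E-congˡ : ∀ k {n} (G : Graph n) {u u′ v} → SameNbh k G u u′ → v ≢ u → v ≢ u′ →
                  E G u v ≡ E G u′ v
sameNbh⇒E-congˡ nonadjacent G S _ _ = S _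
sameNbh⇒E-congˡ adjacent G {v = v} S v≢u v≢u′ =
  trans (sym (closedNbh-≢ G v≢u)) (trans (S v) (closedNbh-≢ G v≢u′))

module _ {n} (k : TwinKind) (G : Graph n) where

  sameNbh-refl : Reflexive (SameNbh k G)
  sameNbh-refl _ = refl

  sameNbh-sym : Symmetric (SameNbh k G)
  sameNbh-sym S w = sym (S w)

  sameNbh-trans : Transitive (SameNbh k G)
  sameNbh-trans S S′ w = trans (S w) (S′ w)

  IsAut⇒sameNbh : ∀ α → IsAut G α → ∀ {u v} → SameNbh k G u v →
                  SameNbh k G (α ⟨$⟩ʳ u) (α ⟨$⟩ʳ v)
  IsAut⇒sameNbh α A {u} {v} S w = begin
    nbh k G (α ⟨$⟩ʳ u) w                  ≡⟨ cong (nbh k G (α ⟨$⟩ʳ u)) (sym (inverseʳ α)) ⟩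
    nbh k G (α ⟨$⟩ʳ u) (α ⟨$⟩ʳ (α ⟨$⟩ˡ w)) ≡⟨ IsAut⇒nbh-invariant k G α A u _ ⟩
    nbh k G u (α ⟨$⟩ˡ w)                  ≡⟨ S _ ⟩
    nbh k G v (α ⟨$⟩ˡ w)                  ≡⟨ IsAut⇒nbh-invariant k G α A v _ ⟨
    nbh k G (α ⟨$⟩ʳ v) (α ⟨$⟩ʳ (α ⟨$⟩ˡ w)) ≡⟨ cong (nbh k G (α ⟨$⟩ʳ v)) (inverseʳ α) ⟩
    nbh k G (α ⟨$⟩ʳ v) w                  ∎

  FixesTwinClasses : Permutation′ n → Set
  FixesTwinClasses π = ∀ u → SameNbh k G (π ⟨$⟩ʳ u) u

  fixesTwinClasses-resp : ∀ {π π′} → π ≈ π′ → FixesTwinClasses π′ → FixesTwinClasses π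
  fixesTwinClasses-resp π≈π′ fixes u = subst (λ x → SameNbh k G x u) (sym (π≈π′ u)) (fixes u)

  fixesTwinClasses-∘transpose : ∀ {ρ i j} → FixesTwinClasses ρ → SameNbh k G i j →
                                FixesTwinClasses (ρ ∘ₚ transpose i j)
  fixesTwinClasses-∘transpose {ρ} fixes S u = sameNbh-trans {j = ρ ⟨$⟩ʳ u}
    (transpose-preserves (SameNbh k G) sameNbh-refl sameNbh-sym S (ρ ⟨$⟩ʳ u)) (fixes u)

  InTwinGroup⇒fixesTwinClasses : ∀ {t} → InTwinGroup k G t → FixesTwinClasses t
  InTwinGroup⇒fixesTwinClasses (gen-id {t} t≈id) =
    fixesTwinClasses-resp {t} {id} t≈id (λ _ → sameNbh-refl)
  InTwinGroup⇒fixesTwinClasses (gen-step {σ} {ρ} {u} {v} ρ∈T (_ , S) σ≈ρ∘τ) =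
    fixesTwinClasses-resp {σ} {ρ ∘ₚ transpose u v} σ≈ρ∘τ
      (fixesTwinClasses-∘transpose {ρ} (InTwinGroup⇒fixesTwinClasses ρ∈T) S)

  fixesTwinClasses⇒InTwinGroup : ∀ {π} → FixesTwinClasses π → InTwinGroup k G π
  fixesTwinClasses⇒InTwinGroup fixes =
    generate (allFin n) fixes (λ x x∉ → contradiction (∈-allFin x) x∉)
    where
    generate : ∀ ys {π} → FixesTwinClasses π → FixedOutside ys π → InTwinGroup k G π
    generate [] _ fixed = gen-id (λ x → fixed x λ ())
    generate (y ∷ ys) {π} fixes fixed with π ⟨$⟩ʳ y ≟ y
    ... | yes πy≡y = generate ys fixes (fixedOutside-∷ {π = π} fixed πy≡y)
    ... | no πy≢y = gen-step {ρ = ρ} {u = y} {v = π ⟨$⟩ʳ y}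
      (generate ys (fixesTwinClasses-∘transpose {π} fixes (fixes y))
                   (fixedOutside-∘transpose {π = π} fixed))
      ((λ y≡πy → πy≢y (sym y≡πy)) , sameNbh-sym (fixes y))
      (λ x → sym (PC.transpose-inverse y (π ⟨$⟩ʳ y)))
      where ρ = π ∘ₚ transpose (π ⟨$⟩ʳ y) y

  InTwinGroup-conjugate : ∀ α {t} → IsAut G α → InTwinGroup k G t →
                          InTwinGroup k G (flip α ∘ₚ t ∘ₚ α)
  InTwinGroup-conjugate α A t∈T = fixesTwinClasses⇒InTwinGroup λ x →
    subst (SameNbh k G _) (inverseʳ α)
      (IsAut⇒sameNbh α A (InTwinGroup⇒fixesTwinClasses t∈T (α ⟨$⟩ˡ x)))

module _ {n m} {k : TwinKind} {G : Graph n} (Q : TwinQuotient k G m) where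

  rep : Fin m → Fin n
  rep j = proj₁ (cls-surj Q j)

  cls-rep : ∀ j → cls Q (rep j) ≡ j
  cls-rep j = proj₂ (cls-surj Q j)

  cls≡⇒sameNbh : ∀ {u v} → cls Q u ≡ cls Q v → SameNbh k G u v
  cls≡⇒sameNbh {u} {v} = Equivalence.to (cls-eq Q u v)

  sameNbh⇒cls≡ : ∀ {u v} → SameNbh k G u v → cls Q u ≡ cls Q v
  sameNbh⇒cls≡ {u} {v} = Equivalence.from (cls-eq Q u v)

  LambdaIs-id⇒fixesTwinClasses : ∀ {π} → LambdaIs Q π id → FixesTwinClasses k G π
  LambdaIs-id⇒fixesTwinClasses l u = cls≡⇒sameNbh (l u)

  fixesTwinClasses⇒LambdaIs-id : ∀ {π} → FixesTwinClasses k G π → LambdaIs Q π id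
  fixesTwinClasses⇒LambdaIs-id fixes u = sameNbh⇒cls≡ (fixes u)

  LambdaIs-unique : ∀ {α β β′} → LambdaIs Q α β → LambdaIs Q α β′ → β ≈ β′
  LambdaIs-unique {α} {β} {β′} l l′ j = begin
    β ⟨$⟩ʳ j               ≡⟨ cong (β ⟨$⟩ʳ_) (cls-rep j) ⟨
    β ⟨$⟩ʳ cls Q (rep j)   ≡⟨ l (rep j) ⟨
    cls Q (α ⟨$⟩ʳ rep j)   ≡⟨ l′ (rep j) ⟩
    β′ ⟨$⟩ʳ cls Q (rep j)  ≡⟨ cong (β′ ⟨$⟩ʳ_) (cls-rep j) ⟩
    β′ ⟨$⟩ʳ j              ∎

  LambdaIs-resp : ∀ {α α′ β β′} → α ≈ α′ → β ≈ β′ → LambdaIs Q α β → LambdaIs Q α′ β′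
  LambdaIs-resp α≈α′ β≈β′ l u = trans (cong (cls Q) (sym (α≈α′ u))) (trans (l u) (β≈β′ (cls Q u)))

  LambdaIs-∘ : ∀ {α α′ β β′} → LambdaIs Q α β → LambdaIs Q α′ β′ → LambdaIs Q (α ∘ₚ α′) (β ∘ₚ β′)
  LambdaIs-∘ {α} {β′ = β′} l l′ u = trans (l′ (α ⟨$⟩ʳ u)) (cong (β′ ⟨$⟩ʳ_) (l u))

  LambdaIs-flip : ∀ {α β} → LambdaIs Q α β → LambdaIs Q (flip α) (flip β)
  LambdaIs-flip {α} {β} l u = begin
    cls Q (α ⟨$⟩ˡ u)                        ≡⟨ inverseˡ β ⟨
    β ⟨$⟩ˡ (β ⟨$⟩ʳ cls Q (α ⟨$⟩ˡ u))         ≡⟨ cong (β ⟨$⟩ˡ_) (l (α ⟨$⟩ˡ u)) ⟨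
    β ⟨$⟩ˡ cls Q (α ⟨$⟩ʳ (α ⟨$⟩ˡ u))         ≡⟨ cong (λ x → β ⟨$⟩ˡ cls Q x) (inverseʳ α) ⟩
    β ⟨$⟩ˡ cls Q u                          ∎

  cls-IsAut : ∀ α → IsAut G α → ∀ {u v} → cls Q u ≡ cls Q v → cls Q (α ⟨$⟩ʳ u) ≡ cls Q (α ⟨$⟩ʳ v)
  cls-IsAut α A e = sameNbh⇒cls≡ (IsAut⇒sameNbh k G α A (cls≡⇒sameNbh e))

  quotientMap : Permutation′ n → Fin m → Fin m
  quotientMap α j = cls Q (α ⟨$⟩ʳ rep j)

  cls-quotientMap : ∀ α → IsAut G α → ∀ u → cls Q (α ⟨$⟩ʳ u) ≡ quotientMap α (cls Q u)
  cls-quotientMap α A u = cls-IsAut α A (sym (cls-rep (cls Q u)))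

  quotientMap-inverse : ∀ α → IsAut G α → ∀ j → quotientMap α (quotientMap (flip α) j) ≡ j
  quotientMap-inverse α A j = begin
    quotientMap α (cls Q (α ⟨$⟩ˡ rep j)) ≡⟨ cls-quotientMap α A _ ⟨
    cls Q (α ⟨$⟩ʳ (α ⟨$⟩ˡ rep j))        ≡⟨ cong (cls Q) (inverseʳ α) ⟩
    cls Q (rep j)                       ≡⟨ cls-rep j ⟩
    j                                   ∎

  quotientPerm : ∀ α → IsAut G α → Permutation′ m
  quotientPerm α A = permutation (quotientMap α) (quotientMap (flip α))
    (quotientMap-inverse α A) (quotientMap-inverse (flip α) (IsAut-flip G α A))

  LambdaIs-quotientPerm : ∀ α (A : IsAut G α) → LambdaIs Q α (quotientPerm α A)
  LambdaIs-quotientPerm = cls-quotientMap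

  cls-IsAut⁻¹ : ∀ α → IsAut G α → ∀ {u v} → cls Q (α ⟨$⟩ʳ u) ≡ cls Q (α ⟨$⟩ʳ v) → cls Q u ≡ cls Q v
  cls-IsAut⁻¹ α A {u} {v} e = permutation-injective (quotientPerm α A)
    (trans (sym (LambdaIs-quotientPerm α A u)) (trans e (LambdaIs-quotientPerm α A v)))

  QAdj-image : ∀ α β → IsAut G α → LambdaIs Q α β → ∀ {i j} → QAdj Q i j →
               QAdj Q (β ⟨$⟩ʳ i) (β ⟨$⟩ʳ j)
  QAdj-image α β A l (i≢j , u , v , refl , refl , e) =
    (λ βi≡βj → i≢j (permutation-injective β βi≡βj)) ,
    α ⟨$⟩ʳ u , α ⟨$⟩ʳ v , l u , l v , trans (A u v) e

  IsAut⇒IsAutQ : ∀ α β → IsAut G α → LambdaIs Q α β → IsAutQ Q β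
  IsAut⇒IsAutQ α β A l i j = mk⇔ (QAdj-image α β A l) λ q →
    subst₂ (QAdj Q) (inverseˡ β) (inverseˡ β)
      (QAdj-image (flip α) (flip β) (IsAut-flip G α A) (LambdaIs-flip {α} {β} l) q)

  E-cls-congˡ : ∀ {u u′ v} → cls Q u ≡ cls Q u′ → cls Q u ≢ cls Q v → E G u v ≡ E G u′ v
  E-cls-congˡ e ne = sameNbh⇒E-congˡ k G (cls≡⇒sameNbh e)
    (λ v≡u → ne (cong (cls Q) (sym v≡u))) (λ v≡u′ → ne (trans e (cong (cls Q) (sym v≡u′))))

  E-cls-cong : ∀ {u u′ v v′} → cls Q u ≡ cls Q u′ → cls Q v ≡ cls Q v′ → cls Q u ≢ cls Q v →
               E G u v ≡ E G u′ v′
  E-cls-cong {u} {u′} {v} {v′} eu ev ne = begin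
    E G u v    ≡⟨ E-cls-congˡ eu ne ⟩
    E G u′ v   ≡⟨ Graph.sym G u′ v ⟩
    E G v u′   ≡⟨ E-cls-congˡ ev (λ v≡u′ → ne (trans eu (sym v≡u′))) ⟩
    E G v′ u′  ≡⟨ Graph.sym G v′ u′ ⟩
    E G u′ v′  ∎

  E≡true⇔QAdj : ∀ {u v i j} → cls Q u ≡ i → cls Q v ≡ j → i ≢ j → E G u v ≡ true ⇔ QAdj Q i j
  E≡true⇔QAdj {u} {v} refl refl i≢j = mk⇔ (λ e → i≢j , u , v , refl , refl , e)
    λ { (_ , u′ , v′ , eu , ev , e) → trans (E-cls-cong (sym eu) (sym ev) i≢j) e }

  IsAutQ⇒E-invariant-across : ∀ {α β} → IsAutQ Q β → LambdaIs Q α β → ∀ {u v} → cls Q u ≢ cls Q v →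
                              E G (α ⟨$⟩ʳ u) (α ⟨$⟩ʳ v) ≡ E G u v
  IsAutQ⇒E-invariant-across {β = β} B l {u} {v} ne = ⇔→≡ (
    ⇔.trans (E≡true⇔QAdj (l u) (l v) (λ βu≡βv → ne (permutation-injective β βu≡βv)))
    (⇔.trans (⇔.sym (B (cls Q u) (cls Q v))) (⇔.sym (E≡true⇔QAdj refl refl ne))))

  record HomSection : Set where
    field
      section          : Permutation′ m → Permutation′ n
      section-aut      : ∀ β → IsAutQ Q β → IsAut G (section β)
      section-cong     : ∀ {β β′} → β ≈ β′ → section β ≈ section β′
      section-∘        : ∀ β β′ → section (β ∘ₚ β′) ≈ section β ∘ₚ section β′
      section-id       : section id ≈ id
      LambdaIs-section : ∀ β → LambdaIs Q (section β) β

  homSection⇒semidirect : HomSection →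
    (∀ β → IsAutQ Q β → ∃ λ α → IsAut G α × LambdaIs Q α β) × SemidirectDecomposition Q
  homSection⇒semidirect S =
    (λ β B → s β , section-aut β B , LambdaIs-section β) ,
    (λ α _ → InTwinGroup-conjugate k G α) ,
    s , section-aut , (λ _ _ _ _ → section-cong) , (λ β β′ _ _ → section-∘ β β′) ,
    (λ β β′ _ _ → section-injective β β′) , (λ β _ → LambdaIs-section β) ,
    (λ β _ → T∩image-trivial β) , decompose
    where
    open HomSection S renaming (section to s)

    section-injective : ∀ β β′ → s β ≈ s β′ → β ≈ β′
    section-injective β β′ sβ≈sβ′ =
      LambdaIs-unique {s β′} {β} {β′}
        (LambdaIs-resp {s β} {s β′} {β} {β} sβ≈sβ′ (λ _ → refl) (LambdaIs-section β))
        (LambdaIs-section β′)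

    T∩image-trivial : ∀ β → InTwinGroup k G (s β) → s β ≈ id
    T∩image-trivial β sβ∈T u = trans (section-cong β≈id u) (section-id u)
      where
      β≈id : β ≈ id
      β≈id = LambdaIs-unique {s β} {β} {id} (LambdaIs-section β)
        (fixesTwinClasses⇒LambdaIs-id {s β} (InTwinGroup⇒fixesTwinClasses k G sβ∈T))

    decompose : ∀ α → IsAut G α →
                ∃ λ t → ∃ λ β → InTwinGroup k G t × IsAutQ Q β × α ≈ (s β ∘ₚ t)
    decompose α A = t , β , t∈T , IsAut⇒IsAutQ α β A (LambdaIs-quotientPerm α A) ,
                    (λ x → cong (α ⟨$⟩ʳ_) (sym (inverseˡ (s β))))
      where
      β = quotientPerm α A
      t = flip (s β) ∘ₚ α
      t∈T : InTwinGroup k G t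
      t∈T = fixesTwinClasses⇒InTwinGroup k G (LambdaIs-id⇒fixesTwinClasses {t}
        (LambdaIs-resp {t} {t} {flip β ∘ₚ β} {id} (λ _ → refl) (λ _ → inverseʳ β)
          (LambdaIs-∘ {flip (s β)} {α} {flip β} {β} (LambdaIs-flip {s β} {β} (LambdaIs-section β))
                      (LambdaIs-quotientPerm α A))))

  module _ (vt : VertexTransitive G) (u₀ : Fin n) where
    private
      τ : Fin m → Permutation′ n
      τ j = proj₁ (vt u₀ (rep j))

      τ-aut : ∀ j → IsAut G (τ j)
      τ-aut j = proj₁ (proj₂ (vt u₀ (rep j)))

      cls-τ-u₀ : ∀ j → cls Q (τ j ⟨$⟩ʳ u₀) ≡ j
      cls-τ-u₀ j = trans (cong (cls Q) (proj₂ (proj₂ (vt u₀ (rep j))))) (cls-rep j)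

      cls-τ⁻¹ : ∀ u → cls Q (τ (cls Q u) ⟨$⟩ˡ u) ≡ cls Q u₀
      cls-τ⁻¹ u = cls-IsAut⁻¹ (τ (cls Q u)) (τ-aut (cls Q u))
        (trans (cong (cls Q) (inverseʳ (τ (cls Q u)))) (sym (cls-τ-u₀ (cls Q u))))

      lift : (Fin m → Fin m) → Fin n → Fin n
      lift h u = τ (h (cls Q u)) ⟨$⟩ʳ (τ (cls Q u) ⟨$⟩ˡ u)

      cls-lift : ∀ h u → cls Q (lift h u) ≡ h (cls Q u)
      cls-lift h u = trans (cls-IsAut (τ (h (cls Q u))) (τ-aut _) (cls-τ⁻¹ u)) (cls-τ-u₀ _)

      lift-within : ∀ h {v j} → cls Q v ≡ j → lift h v ≡ τ (h j) ⟨$⟩ʳ (τ j ⟨$⟩ˡ v)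
      lift-within h {v} = cong (λ j → τ (h j) ⟨$⟩ʳ (τ j ⟨$⟩ˡ v))

      lift-cong : ∀ {h h′} u → h (cls Q u) ≡ h′ (cls Q u) → lift h u ≡ lift h′ u
      lift-cong u = cong (λ j → τ j ⟨$⟩ʳ (τ (cls Q u) ⟨$⟩ˡ u))

      lift-id : ∀ u → lift (λ j → j) u ≡ u
      lift-id u = inverseʳ (τ (cls Q u))

      lift-∘ : ∀ h h′ u → lift h (lift h′ u) ≡ lift (λ j → h (h′ j)) u
      lift-∘ h h′ u = trans (lift-within h (cls-lift h′ u))
        (cong (τ (h (h′ (cls Q u))) ⟨$⟩ʳ_) (inverseˡ (τ (h′ (cls Q u)))))

      lift-inverse : ∀ {h h′} → (∀ j → h (h′ j) ≡ j) → ∀ u → lift h (lift h′ u) ≡ u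
      lift-inverse {h} {h′} hh′≗id u =
        trans (lift-∘ h h′ u)
          (trans (lift-cong {λ j → h (h′ j)} {λ j → j} u (hh′≗id (cls Q u))) (lift-id u))

      lift-E-within : ∀ h {u v} → cls Q u ≡ cls Q v → E G (lift h u) (lift h v) ≡ E G u v
      lift-E-within h {u} {v} e = begin
        E G (lift h u) (lift h v)
          ≡⟨ cong (E G (lift h u)) (lift-within h (sym e)) ⟩
        E G (τ (h j) ⟨$⟩ʳ (τ j ⟨$⟩ˡ u)) (τ (h j) ⟨$⟩ʳ (τ j ⟨$⟩ˡ v))
          ≡⟨ τ-aut (h j) _ _ ⟩
        E G (τ j ⟨$⟩ˡ u) (τ j ⟨$⟩ˡ v)
          ≡⟨ IsAut-flip G (τ j) (τ-aut j) u v ⟩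
        E G u v
          ∎
        where j = cls Q u

      section : Permutation′ m → Permutation′ n
      section β = permutation (lift (β ⟨$⟩ʳ_)) (lift (β ⟨$⟩ˡ_))
        (lift-inverse {β ⟨$⟩ʳ_} {β ⟨$⟩ˡ_} (λ _ → inverseʳ β))
        (lift-inverse {β ⟨$⟩ˡ_} {β ⟨$⟩ʳ_} (λ _ → inverseˡ β))

      section-aut : ∀ β → IsAutQ Q β → IsAut G (section β)
      section-aut β B u v with cls Q u ≟ cls Q v
      ... | yes same = lift-E-within (β ⟨$⟩ʳ_) same
      ... | no differ = IsAutQ⇒E-invariant-across {section β} {β} B (cls-lift (β ⟨$⟩ʳ_)) differ

    homSection-through : HomSection
    homSection-through = record
      { section          = section
      ; section-aut      = section-aut
      ; section-cong     = λ {β} {β′} β≈β′ u → lift-cong {β ⟨$⟩ʳ_} {β′ ⟨$⟩ʳ_} u (β≈β′ (cls Q u))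
      ; section-∘        = λ β β′ u → sym (lift-∘ (β′ ⟨$⟩ʳ_) (β ⟨$⟩ʳ_) u)
      ; section-id       = lift-id
      ; LambdaIs-section = λ β → cls-lift (β ⟨$⟩ʳ_)
      }

vertexTransitive⇒homSection : ∀ {n m k} {G : Graph n} (Q : TwinQuotient k G m) →
                              VertexTransitive G → HomSection Q
vertexTransitive⇒homSection {zero} Q _ = record
  { section          = λ _ → id
  ; section-aut      = λ _ _ ()
  ; section-cong     = λ _ ()
  ; section-∘        = λ _ _ ()
  ; section-id       = λ ()
  ; LambdaIs-section = λ _ ()
  }
vertexTransitive⇒homSection {suc n} Q vt = homSection-through Q vt 0F

proposition10 : (k : TwinKind) (n : ℕ) (G : Graph n) →
    VertexTransitive G →
    (∀ u → ∃ λ v → Twins k G u v) →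
    (m : ℕ) (Q : TwinQuotient k G m) →
    (∀ β → IsAutQ Q β → ∃ λ α → IsAut G α × LambdaIs Q α β)
    × SemidirectDecomposition Q
proposition10 k n G vt _ m Q = homSection⇒semidirect Q (vertexTransitive⇒homSection Q vt)
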